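{- Let $S$ be an equivariant system of ideals for a commutative preordered group $G$. Then the meet-monoid generated by $S$ on $G$ is cancellative if and only if $S$ is regular.
   Context: $G$ is an abelian group with a preorder $\leqslant$ such that $a\leqslant b$ implies $a+c\leqslant b+c$. For nonempty finite subsets write $A,B$ for $A\cup B$, $a$ for $\{a\}$, $A\pm x=\{a\pm x:a\in A\}$, $A+B=\{a+b:a\in A,b\in B\}$. An equivariant system of ideals is a predicate $S$ on nonempty finite subsets of $G$ such that: (P1) $S(A)$ if $A\supseteq A'$ and $S(A')$; (P2') $S(A)$ if $S(A,u)$ and $S(A-u)$; (P3) $S(a)$ if $a\leqslant 0$. It is regular if moreover (P2) $S(A+B)$ whenever $S(A+B,A)$ and $S(A+B,B)$, and (P5) $S(x,-x)$ for all $x\in G$. The meet-monoid generated by $S$ on $G$ is the set of nonempty finite subsets of $G$ with monoid operation $A+B$, meet $A\wedge B=A\cup B$, and preorder $A\leqslant_S B$ iff $S(A-b)$ for every $b\in B$. It is cancellative if $A+C\leqslant_S B+C$ implies $A\leqslant_S B$. -}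

module Defs where

open import Level using (Level; _⊔_; suc)
open import Algebra.Bundles using (AbelianGroup)
open import Relation.Binary using (Rel; IsPreorder)
open import Data.List.NonEmpty using (List⁺; [_]; _⁺++⁺_; map; concatMap; toList)
open import Data.List.Relation.Unary.Any using (Any)
open import Data.Product using (_×_)

record PreorderedAbelianGroup (c ℓ₁ ℓ₂ : Level) : Set (suc (c ⊔ ℓ₁ ⊔ ℓ₂)) where
  field
    abelianGroup : AbelianGroup c ℓ₁
  open AbelianGroup abelianGroup public
  infix 4 _≤_
  field
    _≤_        : Rel Carrier ℓ₂
    isPreorder : IsPreorder _≈_ _≤_
    compat     : ∀ {a b} (c : Carrier) → a ≤ b → (a ∙ c) ≤ (b ∙ c)

module _ {c ℓ₁ ℓ₂ : Level} (G : PreorderedAbelianGroup c ℓ₁ ℓ₂) where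
  open PreorderedAbelianGroup G

  -- Nonempty finite subsets of G are represented by nonempty lists;
  -- membership is taken up to the group's equality.
  FinSub : Set c
  FinSub = List⁺ Carrier

  _∈_ : Carrier → FinSub → Set (c ⊔ ℓ₁)
  x ∈ A = Any (x ≈_) (toList A)

  _⊇_ : FinSub → FinSub → Set (c ⊔ ℓ₁)
  A ⊇ A' = ∀ x → x ∈ A' → x ∈ A

  _∪_ : FinSub → FinSub → FinSub
  A ∪ B = A ⁺++⁺ B

  _+ₑ_ : FinSub → Carrier → FinSub
  A +ₑ x = map (λ a → a ∙ x) A

  _-ₑ_ : FinSub → Carrier → FinSub
  A -ₑ x = map (λ a → a ∙ (x ⁻¹)) A

  _⊕_ : FinSub → FinSub → FinSub
  A ⊕ B = concatMap (λ a → map (λ b → a ∙ b) B) A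

  record IsEquivariantSystem {ℓ : Level} (S : FinSub → Set ℓ) : Set (c ⊔ ℓ₁ ⊔ ℓ₂ ⊔ ℓ) where
    field
      P1  : ∀ A A' → A ⊇ A' → S A' → S A
      P2' : ∀ A u → S (A ∪ [ u ]) → S (A -ₑ u) → S A
      P3  : ∀ a → a ≤ ε → S [ a ]

  record IsRegular {ℓ : Level} (S : FinSub → Set ℓ) : Set (c ⊔ ℓ₁ ⊔ ℓ₂ ⊔ ℓ) where
    field
      isEquivariantSystem : IsEquivariantSystem S
      P2 : ∀ A B → S ((A ⊕ B) ∪ A) → S ((A ⊕ B) ∪ B) → S (A ⊕ B)
      P5 : ∀ x → S ([ x ] ∪ [ x ⁻¹ ])

  -- The preorder of the meet-monoid generated by S on G.
  _≤[_]_ : {ℓ : Level} → FinSub → (FinSub → Set ℓ) → FinSub → Set (c ⊔ ℓ₁ ⊔ ℓ)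
  A ≤[ S ] B = ∀ b → b ∈ B → S (A -ₑ b)

  Cancellative : {ℓ : Level} → (FinSub → Set ℓ) → Set (c ⊔ ℓ₁ ⊔ ℓ)
  Cancellative S = ∀ A B C → (A ⊕ C) ≤[ S ] (B ⊕ C) → A ≤[ S ] B

-- Cancellativity amounts to its special case B = {0}: A ⊕ C ≤ₛ C implies S A, because
-- (A ⊕ C) − (b + c) ⊆ ((A − b) ⊕ C) − c.
--
-- Regularity gives this by induction on C. For C = {u} ∪ C′ and c ∈ C′ put
-- Z = (A ⊕ C′) − c and v = u − c: by P1 the hypotheses at c and at u give S(Z, Z + v)
-- and S(Z, Z − v). Applying P2 to (Z + v) ∪ {2v} and {−v}, whose sum is Z ∪ {v}, with P5
-- for the second premise turns S(Z, Z + v) into S(Z, v); P2 applied to Z − v and {v}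
-- then yields S Z. Hence A ⊕ C′ ≤ₛ C′, and at the end S A.
--
-- Conversely P5 and P2 are instances of cancellation, with C = {0, x} for P5 and
-- C = {0} ∪ A ∪ B ∪ D for P2, where D = A ⊕ B: for a ∈ A the set (D ⊕ C) − a contains
-- D ∪ B, symmetrically for b ∈ B, for d ∈ D it contains 0, and at 0 the premise S(D, A)
-- is combined with the case of the points of A by P2'.
module Submission where

open import Defs
  using (PreorderedAbelianGroup; FinSub; IsEquivariantSystem; IsRegular; Cancellative)
import Defs
open import Level using (Level; _⊔_)
open import Function.Base using (_∘_)
open import Function.Bundles using (_⇔_; mk⇔)
open import Data.Product using (_×_; _,_; ∃; ∃₂)
open import Data.Sum using (_⊎_; inj₁; inj₂)
open import Data.List as List using ([]; _∷_; cartesianProductWith)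
open import Data.List.NonEmpty as List⁺ using (_∷_; [_]; toList; _∷⁺_)
open import Data.List.Relation.Unary.Any as Any using (Any; here; there)
open import Data.List.Membership.Propositional using (find)
open import Data.List.Membership.Propositional.Properties
  using (∈-++⁻; ∈-map⁻; ∈-cartesianProductWith⁻)
import Data.List.Membership.Setoid.Properties as SetoidMembership
open import Relation.Binary.PropositionalEquality as ≡ using (_≡_)
import Algebra.Properties.AbelianGroup as AbelianGroupProperties
import Relation.Binary.Reasoning.Setoid as SetoidReasoning
open import Relation.Binary.Structures using (IsPreorder)

module _ {c ℓ₁ ℓ₂ : Level} (G : PreorderedAbelianGroup c ℓ₁ ℓ₂) where
  open PreorderedAbelianGroup G
  open AbelianGroupProperties abelianGroup
    using ( //-rightDividesˡ; //-rightDividesʳ; \\-leftDividesʳ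
          ; ε⁻¹≈ε; ⁻¹-anti-homo‿-; ⁻¹-∙-comm)
  open SetoidReasoning setoid

  infix  4 _∈_ _∈ₗ_ _⊇_
  infixr 5 _∪_

  _∈_ : Carrier → FinSub G → Set (c ⊔ ℓ₁)
  _∈_ = Defs._∈_ G

  _⊇_ : FinSub G → FinSub G → Set (c ⊔ ℓ₁)
  _⊇_ = Defs._⊇_ G

  _∪_ : FinSub G → FinSub G → FinSub G
  _∪_ = Defs._∪_ G

  _+ₑ_ : FinSub G → Carrier → FinSub G
  _+ₑ_ = Defs._+ₑ_ G

  _-ₑ_ : FinSub G → Carrier → FinSub G
  _-ₑ_ = Defs._-ₑ_ G

  _⊕_ : FinSub G → FinSub G → FinSub G
  _⊕_ = Defs._⊕_ G

  _∈ₗ_ : Carrier → FinSub G → Set c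
  x ∈ₗ A = Any (x ≡_) (toList A)

  x-ε≈x : ∀ x → x - ε ≈ x
  x-ε≈x x = trans (∙-congˡ ε⁻¹≈ε) (identityʳ x)

  x-z-[y-z]≈x-y : ∀ x y z → (x - z) - (y - z) ≈ x - y
  x-z-[y-z]≈x-y x y z = begin
    (x - z) - (y - z)        ≈⟨ ∙-congˡ (⁻¹-anti-homo‿- y z) ⟩
    (x - z) ∙ (z - y)        ≈⟨ assoc x (z ⁻¹) (z - y) ⟩
    x ∙ (z ⁻¹ ∙ (z - y))     ≈⟨ ∙-congˡ (\\-leftDividesʳ z (y ⁻¹)) ⟩
    x - y                    ∎

  [x∙y]-[z∙w]≈[x-z]∙y-w : ∀ x y z w → (x ∙ y) - (z ∙ w) ≈ ((x - z) ∙ y) - w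
  [x∙y]-[z∙w]≈[x-z]∙y-w x y z w = begin
    (x ∙ y) - (z ∙ w)          ≈⟨ ∙-congˡ (⁻¹-∙-comm z w) ⟨
    (x ∙ y) ∙ (z ⁻¹ ∙ w ⁻¹)    ≈⟨ assoc (x ∙ y) (z ⁻¹) (w ⁻¹) ⟨
    ((x ∙ y) - z) - w          ≈⟨ ∙-congʳ (assoc x y (z ⁻¹)) ⟩
    (x ∙ (y - z)) - w          ≈⟨ ∙-congʳ (∙-congˡ (comm y (z ⁻¹))) ⟩
    (x ∙ (z ⁻¹ ∙ y)) - w       ≈⟨ ∙-congʳ (assoc x (z ⁻¹) y) ⟨
    ((x - z) ∙ y) - w          ∎

  toList-⊕ : ∀ A B → toList (A ⊕ B) ≡ cartesianProductWith _∙_ (toList A) (toList B)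
  toList-⊕ A B = go (toList A)
    where
    go : ∀ as → List.concat (List.map toList (List.map (λ a → List⁺.map (a ∙_) B) as))
                ≡ cartesianProductWith _∙_ as (toList B)
    go []       = ≡.refl
    go (a ∷ as) = ≡.cong (List.map (a ∙_) (toList B) List.++_) (go as)

  ∈-resp-≈ : ∀ {x y A} → x ≈ y → x ∈ A → y ∈ A
  ∈-resp-≈ = SetoidMembership.∈-resp-≈ setoid

  ∈-[_] : ∀ x → x ∈ [ x ]
  ∈-[ x ] = here refl

  ∈-∪⁺ˡ : ∀ {x A B} → x ∈ A → x ∈ A ∪ B
  ∈-∪⁺ˡ = SetoidMembership.∈-++⁺ˡ setoid

  ∈-∪⁺ʳ : ∀ {x} A {B} → x ∈ B → x ∈ A ∪ B
  ∈-∪⁺ʳ A = SetoidMembership.∈-++⁺ʳ setoid (toList A)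

  ∈-+ₑ⁺ : ∀ {x A} v → x ∈ A → x ∙ v ∈ A +ₑ v
  ∈-+ₑ⁺ v = SetoidMembership.∈-map⁺ setoid setoid ∙-congʳ

  ∈-−ₑ⁺ : ∀ {x A} v → x ∈ A → x - v ∈ A -ₑ v
  ∈-−ₑ⁺ v = ∈-+ₑ⁺ (v ⁻¹)

  ∈-−ₑ-cancel : ∀ {x A} v → x ∙ v ∈ A → x ∈ A -ₑ v
  ∈-−ₑ-cancel {x} v xv∈ = ∈-resp-≈ (//-rightDividesʳ v x) (∈-−ₑ⁺ v xv∈)

  ∈-⊕⁺ : ∀ {x y A B} → x ∈ A → y ∈ B → x ∙ y ∈ A ⊕ B
  ∈-⊕⁺ {x} {y} {A} {B} x∈ y∈ =
    ≡.subst (Any (x ∙ y ≈_)) (≡.sym (toList-⊕ A B))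
      (SetoidMembership.∈-cartesianProductWith⁺ setoid setoid setoid ∙-cong x∈ y∈)

  ∈ₗ⇒∈ : ∀ {x A} → x ∈ₗ A → x ∈ A
  ∈ₗ⇒∈ = Any.map reflexive

  ⊇-intro : ∀ {A B} → (∀ {x} → x ∈ₗ B → x ∈ A) → A ⊇ B
  ⊇-intro f x x∈ with find x∈
  ... | y , y∈ , x≈y = ∈-resp-≈ (sym x≈y) (f y∈)

  ∈ₗ-∪⁻ : ∀ {x} A B → x ∈ₗ A ∪ B → x ∈ₗ A ⊎ x ∈ₗ B
  ∈ₗ-∪⁻ A B = ∈-++⁻ (toList A)

  ∈ₗ-+ₑ⁻ : ∀ {x} A v → x ∈ₗ A +ₑ v → ∃ λ a → a ∈ₗ A × x ≡ a ∙ v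
  ∈ₗ-+ₑ⁻ A v = ∈-map⁻ (_∙ v)

  ∈ₗ-−ₑ⁻ : ∀ {x} A v → x ∈ₗ A -ₑ v → ∃ λ a → a ∈ₗ A × x ≡ a - v
  ∈ₗ-−ₑ⁻ A v = ∈ₗ-+ₑ⁻ A (v ⁻¹)

  ∈ₗ-⊕⁻ : ∀ {x} A B → x ∈ₗ A ⊕ B → ∃₂ λ a b → a ∈ₗ A × b ∈ₗ B × x ≡ a ∙ b
  ∈ₗ-⊕⁻ A B x∈ =
    ∈-cartesianProductWith⁻ _∙_ (toList A) (toList B) (≡.subst (Any _) (toList-⊕ A B) x∈)

  ∈ₗ-⊕[]⁻ : ∀ {x} A b → x ∈ₗ A ⊕ [ b ] → ∃ λ a → a ∈ₗ A × x ≡ a ∙ b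
  ∈ₗ-⊕[]⁻ A b x∈ with ∈ₗ-⊕⁻ A [ b ] x∈
  ... | a , _ , a∈ , here ≡.refl , ≡.refl = a , a∈ , ≡.refl

  ⊇-refl : ∀ {A} → A ⊇ A
  ⊇-refl _ x∈ = x∈

  ⊇-[] : ∀ {a A} → a ∈ A → A ⊇ [ a ]
  ⊇-[] a∈ _ (here x≈a) = ∈-resp-≈ (sym x≈a) a∈

  ∪-⊇ˡ : ∀ {A B} → A ∪ B ⊇ A
  ∪-⊇ˡ _ = ∈-∪⁺ˡ

  ∪-least : ∀ {X A B} → X ⊇ A → X ⊇ B → X ⊇ A ∪ B
  ∪-least {A = A} X⊇A X⊇B x x∈ with SetoidMembership.∈-++⁻ setoid (toList A) x∈
  ... | inj₁ x∈A = X⊇A x x∈A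
  ... | inj₂ x∈B = X⊇B x x∈B

  ∪-mono : ∀ {A A′ B B′} → A ⊇ A′ → B ⊇ B′ → A ∪ B ⊇ A′ ∪ B′
  ∪-mono {A} A⊇A′ B⊇B′ = ∪-least (λ x → ∈-∪⁺ˡ ∘ A⊇A′ x) (λ x → ∈-∪⁺ʳ A ∘ B⊇B′ x)

  ⊇-[ε]⊕ : ∀ {A} → A ⊇ [ ε ] ⊕ A
  ⊇-[ε]⊕ {A} = ⊇-intro elim
    where
    elim : ∀ {x} → x ∈ₗ [ ε ] ⊕ A → x ∈ A
    elim x∈ with ∈ₗ-⊕⁻ [ ε ] A x∈
    ... | _ , a , here ≡.refl , a∈ , ≡.refl = ∈-resp-≈ (sym (identityˡ a)) (∈ₗ⇒∈ a∈)

  ⊇-⊕[ε] : ∀ {A B} → ε ∈ B → A ⊕ B ⊇ A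
  ⊇-⊕[ε] ε∈ = ⊇-intro λ {a} a∈ → ∈-resp-≈ (identityʳ a) (∈-⊕⁺ (∈ₗ⇒∈ a∈) ε∈)

  ⊇-⊕-−ₑ : ∀ {X A B t} → (∀ {a b} → a ∈ₗ A → b ∈ₗ B → (a ∙ b) - t ∈ X) → X ⊇ (A ⊕ B) -ₑ t
  ⊇-⊕-−ₑ {X} {A} {B} {t} f = ⊇-intro elim
    where
    elim : ∀ {x} → x ∈ₗ (A ⊕ B) -ₑ t → x ∈ X
    elim x∈ with ∈ₗ-−ₑ⁻ (A ⊕ B) t x∈
    ... | w , w∈ , ≡.refl with ∈ₗ-⊕⁻ A B w∈
    ... | a , b , a∈ , b∈ , ≡.refl = f a∈ b∈

  module EquivariantSystem {ℓ} {S : FinSub G → Set ℓ} (sys : IsEquivariantSystem G S) where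
    open IsEquivariantSystem sys

    infix 4 _≤ₛ_
    _≤ₛ_ : FinSub G → FinSub G → Set (c ⊔ ℓ₁ ⊔ ℓ)
    A ≤ₛ B = Defs._≤[_]_ G A S B

    ε∈⇒S : ∀ {A} → ε ∈ A → S A
    ε∈⇒S ε∈ = P1 _ _ (⊇-[] ε∈) (P3 ε (IsPreorder.refl isPreorder))

    ∈⇒S-−ₑ : ∀ {x A} → x ∈ A → S (A -ₑ x)
    ∈⇒S-−ₑ {x} x∈ = ε∈⇒S (∈-resp-≈ (inverseʳ x) (∈-−ₑ⁺ x x∈))

    S⇒S-−ₑε : ∀ {A} → S A → S (A -ₑ ε)
    S⇒S-−ₑε {A} =
      P1 _ A (⊇-intro λ {x} x∈ → ∈-−ₑ-cancel ε (∈-resp-≈ (sym (identityʳ x)) (∈ₗ⇒∈ x∈)))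

    S-−ₑε⇒S : ∀ {A} → S (A -ₑ ε) → S A
    S-−ₑε⇒S {A} = P1 A _ (⊇-intro shift)
      where
      shift : ∀ {x} → x ∈ₗ A -ₑ ε → x ∈ A
      shift x∈ with ∈ₗ-−ₑ⁻ A ε x∈
      ... | a , a∈ , ≡.refl = ∈-resp-≈ (sym (x-ε≈x a)) (∈ₗ⇒∈ a∈)

    S-−ₑ-resp-≈ : ∀ {A x y} → x ≈ y → S (A -ₑ x) → S (A -ₑ y)
    S-−ₑ-resp-≈ {A} {x} {y} x≈y = P1 _ _ (⊇-intro shift)
      where
      shift : ∀ {z} → z ∈ₗ A -ₑ x → z ∈ A -ₑ y
      shift z∈ with ∈ₗ-−ₑ⁻ A x z∈
      ... | a , a∈ , ≡.refl =
        ∈-resp-≈ (∙-congˡ (⁻¹-cong (sym x≈y))) (∈-−ₑ⁺ y (∈ₗ⇒∈ a∈))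

    ≤ₛ-intro : ∀ {A B} → (∀ {b} → b ∈ₗ B → S (A -ₑ b)) → A ≤ₛ B
    ≤ₛ-intro f b b∈ with find b∈
    ... | b′ , b′∈ , b≈b′ = S-−ₑ-resp-≈ (sym b≈b′) (f b′∈)

    ⊇⇒≤ₛ : ∀ {A B} → A ⊇ B → A ≤ₛ B
    ⊇⇒≤ₛ A⊇B b b∈ = ∈⇒S-−ₑ (A⊇B b b∈)

    cut : ∀ X L → S (X ∪ L) → X ≤ₛ L → S X
    cut X (l ∷ ls) = go l ls
      where
      go : ∀ l ls → S (X ∪ (l ∷ ls)) → X ≤ₛ (l ∷ ls) → S X
      go l []        s X≤L = P2' X l s (X≤L l ∈-[ l ])
      go l (l′ ∷ ls) s X≤L = go l′ ls (P2' (X ∪ L′) l s₁ s₂) (λ a a∈ → X≤L a (there a∈))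
        where
        L′ : FinSub G
        L′ = l′ ∷ ls
        move : ∀ {x} → x ∈ₗ X ∪ (l ∷⁺ L′) → x ∈ (X ∪ L′) ∪ [ l ]
        move x∈ with ∈ₗ-∪⁻ X (l ∷⁺ L′) x∈
        ... | inj₁ x∈X          = ∈-∪⁺ˡ (∈-∪⁺ˡ (∈ₗ⇒∈ x∈X))
        ... | inj₂ (here ≡.refl) = ∈-∪⁺ʳ (X ∪ L′) ∈-[ l ]
        ... | inj₂ (there x∈L′)  = ∈-∪⁺ˡ (∈-∪⁺ʳ X (∈ₗ⇒∈ x∈L′))
        drop : ∀ {x} → x ∈ₗ X -ₑ l → x ∈ (X ∪ L′) -ₑ l
        drop x∈ with ∈ₗ-−ₑ⁻ X l x∈
        ... | a , a∈ , ≡.refl = ∈-−ₑ⁺ l (∈-∪⁺ˡ (∈ₗ⇒∈ a∈))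
        s₁ : S ((X ∪ L′) ∪ [ l ])
        s₁ = P1 _ _ (⊇-intro move) s
        s₂ : S ((X ∪ L′) -ₑ l)
        s₂ = P1 _ _ (⊇-intro drop) (X≤L l (here refl))

  module Regular⇒Cancellative {ℓ} {S : FinSub G → Set ℓ} (reg : IsRegular G S) where
    open IsRegular reg
    open IsEquivariantSystem isEquivariantSystem
    open EquivariantSystem isEquivariantSystem

    absorb-translate : ∀ Z v → S (Z ∪ (Z +ₑ v)) → S (Z ∪ [ v ])
    absorb-translate Z v s =
      P1 _ _ (⊇-intro back) (P2 A [ v ⁻¹ ] (P1 _ _ into₁ s) (P1 _ _ into₂ (P5 v)))
      where
      A : FinSub G
      A = (Z +ₑ v) ∪ [ v ∙ v ]
      unshift : ∀ {x} → x ∙ v ∈ A → x ∈ A ⊕ [ v ⁻¹ ]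
      unshift {x} xv∈ = ∈-resp-≈ (//-rightDividesʳ v x) (∈-⊕⁺ xv∈ ∈-[ v ⁻¹ ])
      into₁ : (A ⊕ [ v ⁻¹ ]) ∪ A ⊇ Z ∪ (Z +ₑ v)
      into₁ = ∪-mono (⊇-intro λ z∈ → unshift (∈-∪⁺ˡ (∈-+ₑ⁺ v (∈ₗ⇒∈ z∈)))) ∪-⊇ˡ
      into₂ : (A ⊕ [ v ⁻¹ ]) ∪ [ v ⁻¹ ] ⊇ [ v ] ∪ [ v ⁻¹ ]
      into₂ = ∪-mono (⊇-[] (unshift (∈-∪⁺ʳ (Z +ₑ v) ∈-[ v ∙ v ]))) ⊇-refl
      back : ∀ {x} → x ∈ₗ A ⊕ [ v ⁻¹ ] → x ∈ Z ∪ [ v ]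
      back x∈ with ∈ₗ-⊕[]⁻ A (v ⁻¹) x∈
      ... | a , a∈ , ≡.refl with ∈ₗ-∪⁻ (Z +ₑ v) [ v ∙ v ] a∈
      ... | inj₂ (here ≡.refl) = ∈-∪⁺ʳ Z (∈-resp-≈ (sym (//-rightDividesʳ v v)) ∈-[ v ])
      ... | inj₁ a∈Z+v with ∈ₗ-+ₑ⁻ Z v a∈Z+v
      ... | z , z∈ , ≡.refl = ∈-∪⁺ˡ (∈-resp-≈ (sym (//-rightDividesʳ v z)) (∈ₗ⇒∈ z∈))

    cut-translate : ∀ Z v → S (Z ∪ [ v ]) → S (Z ∪ (Z -ₑ v)) → S Z
    cut-translate Z v s₁ s₂ =
      P1 _ _ (⊇-intro back) (P2 (Z -ₑ v) [ v ] (P1 _ _ into₁ s₂) (P1 _ _ into₂ s₁))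
      where
      Z⊆ : (Z -ₑ v) ⊕ [ v ] ⊇ Z
      Z⊆ = ⊇-intro λ {z} z∈ →
        ∈-resp-≈ (//-rightDividesˡ v z) (∈-⊕⁺ (∈-−ₑ⁺ v (∈ₗ⇒∈ z∈)) ∈-[ v ])
      into₁ : ((Z -ₑ v) ⊕ [ v ]) ∪ (Z -ₑ v) ⊇ Z ∪ (Z -ₑ v)
      into₁ = ∪-mono Z⊆ ⊇-refl
      into₂ : ((Z -ₑ v) ⊕ [ v ]) ∪ [ v ] ⊇ Z ∪ [ v ]
      into₂ = ∪-mono Z⊆ ⊇-refl
      back : ∀ {x} → x ∈ₗ (Z -ₑ v) ⊕ [ v ] → x ∈ Z
      back x∈ with ∈ₗ-⊕[]⁻ (Z -ₑ v) v x∈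
      ... | a , a∈ , ≡.refl with ∈ₗ-−ₑ⁻ Z v a∈
      ... | z , z∈ , ≡.refl = ∈-resp-≈ (sym (//-rightDividesˡ v z)) (∈ₗ⇒∈ z∈)

    S-from-translates : ∀ Z v → S (Z ∪ (Z +ₑ v)) → S (Z ∪ (Z -ₑ v)) → S Z
    S-from-translates Z v s₊ s₋ = cut-translate Z v (absorb-translate Z v s₊) s₋

    ⊕[]≤ₛ[]⇒S : ∀ A u → A ⊕ [ u ] ≤ₛ [ u ] → S A
    ⊕[]≤ₛ[]⇒S A u h = P1 _ _ (⊇-⊕-−ₑ back) (h u ∈-[ u ])
      where
      back : ∀ {a b} → a ∈ₗ A → b ∈ₗ [ u ] → (a ∙ b) - u ∈ A
      back {a} a∈ (here ≡.refl) = ∈-resp-≈ (sym (//-rightDividesʳ u a)) (∈ₗ⇒∈ a∈)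

    ⊕≤ₛ-tail : ∀ A u C → A ⊕ (u ∷⁺ C) ≤ₛ u ∷⁺ C → A ⊕ C ≤ₛ C
    ⊕≤ₛ-tail A u C h c c∈ = S-from-translates Z v
      (P1 _ _ (⊇-⊕-−ₑ into₊) (h c (there c∈)))
      (P1 _ _ (⊇-⊕-−ₑ into₋) (h u (here refl)))
      where
      Z : FinSub G
      Z = (A ⊕ C) -ₑ c
      v : Carrier
      v = u - c
      A⊆Z : ∀ {a} → a ∈ₗ A → a ∈ Z
      A⊆Z a∈ = ∈-−ₑ-cancel c (∈-⊕⁺ (∈ₗ⇒∈ a∈) c∈)
      into₊ : ∀ {a d} → a ∈ₗ A → d ∈ₗ u ∷⁺ C → (a ∙ d) - c ∈ Z ∪ (Z +ₑ v)
      into₊ {a} a∈ (here ≡.refl) =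
        ∈-∪⁺ʳ Z (∈-resp-≈ (sym (assoc a u (c ⁻¹))) (∈-+ₑ⁺ v (A⊆Z a∈)))
      into₊ a∈ (there d∈) = ∈-∪⁺ˡ (∈-−ₑ⁺ c (∈-⊕⁺ (∈ₗ⇒∈ a∈) (∈ₗ⇒∈ d∈)))
      into₋ : ∀ {a d} → a ∈ₗ A → d ∈ₗ u ∷⁺ C → (a ∙ d) - u ∈ Z ∪ (Z -ₑ v)
      into₋ {a} a∈ (here ≡.refl) = ∈-∪⁺ˡ (∈-resp-≈ (sym (//-rightDividesʳ u a)) (A⊆Z a∈))
      into₋ {a} {d} a∈ (there d∈) =
        ∈-∪⁺ʳ Z (∈-resp-≈ (x-z-[y-z]≈x-y (a ∙ d) u c)
          (∈-−ₑ⁺ v (∈-−ₑ⁺ c (∈-⊕⁺ (∈ₗ⇒∈ a∈) (∈ₗ⇒∈ d∈)))))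

    ⊕≤ₛ⇒S : ∀ A C → A ⊕ C ≤ₛ C → S A
    ⊕≤ₛ⇒S A (u ∷ cs) = go u cs
      where
      go : ∀ u cs → A ⊕ (u ∷ cs) ≤ₛ u ∷ cs → S A
      go u []        = ⊕[]≤ₛ[]⇒S A u
      go u (u′ ∷ cs) = go u′ cs ∘ ⊕≤ₛ-tail A u (u′ ∷ cs)

    cancellative : Cancellative G S
    cancellative A B C A⊕C≤B⊕C b b∈ = ⊕≤ₛ⇒S (A -ₑ b) C λ c c∈ →
      P1 _ _ (⊇-⊕-−ₑ (regroup c)) (A⊕C≤B⊕C (b ∙ c) (∈-⊕⁺ b∈ c∈))
      where
      regroup : ∀ c {a d} → a ∈ₗ A → d ∈ₗ C → (a ∙ d) - (b ∙ c) ∈ ((A -ₑ b) ⊕ C) -ₑ c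
      regroup c {a} {d} a∈ d∈ = ∈-resp-≈ (sym ([x∙y]-[z∙w]≈[x-z]∙y-w a d b c))
        (∈-−ₑ⁺ c (∈-⊕⁺ (∈-−ₑ⁺ b (∈ₗ⇒∈ a∈)) (∈ₗ⇒∈ d∈)))

  module Cancellative⇒Regular {ℓ} {S : FinSub G → Set ℓ}
    (sys : IsEquivariantSystem G S) (cancel : Cancellative G S) where
    open IsEquivariantSystem sys
    open EquivariantSystem sys

    ⊕≤ₛ⇒S : ∀ A C → A ⊕ C ≤ₛ C → S A
    ⊕≤ₛ⇒S A C h = S-−ₑε⇒S (cancel A [ ε ] C (λ y y∈ → h y (⊇-[ε]⊕ y y∈)) ε ∈-[ ε ])

    P5 : ∀ x → S ([ x ] ∪ [ x ⁻¹ ])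
    P5 x = ⊕≤ₛ⇒S A C (⊇⇒≤ₛ (⊇-intro C⊆A⊕C))
      where
      A C : FinSub G
      A = [ x ] ∪ [ x ⁻¹ ]
      C = [ ε ] ∪ [ x ]
      C⊆A⊕C : ∀ {y} → y ∈ₗ C → y ∈ A ⊕ C
      C⊆A⊕C (here ≡.refl) = ∈-resp-≈ (inverseˡ x)
        (∈-⊕⁺ {A = A} {B = C} (∈-∪⁺ʳ [ x ] ∈-[ x ⁻¹ ]) (∈-∪⁺ʳ [ ε ] ∈-[ x ]))
      C⊆A⊕C (there (here ≡.refl)) = ∈-resp-≈ (identityʳ x)
        (∈-⊕⁺ {A = A} {B = C} (∈-∪⁺ˡ ∈-[ x ]) (∈-∪⁺ˡ ∈-[ ε ]))

    P2 : ∀ A B → S ((A ⊕ B) ∪ A) → S ((A ⊕ B) ∪ B) → S (A ⊕ B)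
    P2 A B s₁ s₂ = ⊕≤ₛ⇒S D C (≤ₛ-intro at)
      where
      D C : FinSub G
      D = A ⊕ B
      C = [ ε ] ∪ ((A ∪ B) ∪ D)
      ε∈C : ε ∈ C
      ε∈C = ∈-∪⁺ˡ ∈-[ ε ]
      shift : ∀ {t Y} → t ∈ C → (∀ {y} → y ∈ₗ Y → t ∙ y ∈ D) → (D ⊕ C) -ₑ t ⊇ D ∪ Y
      shift {t} t∈ tY⊆D = ∪-least
        (⊇-intro λ d∈ → ∈-−ₑ-cancel t (∈-⊕⁺ (∈ₗ⇒∈ d∈) t∈))
        (⊇-intro λ {y} y∈ → ∈-−ₑ-cancel t
          (∈-resp-≈ (trans (identityʳ (t ∙ y)) (comm t y)) (∈-⊕⁺ (tY⊆D y∈) ε∈C)))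
      from-A : ∀ {a} → a ∈ A → S ((D ⊕ C) -ₑ a)
      from-A a∈ =
        P1 _ _ (shift (∈-∪⁺ʳ [ ε ] (∈-∪⁺ˡ (∈-∪⁺ˡ a∈))) (λ b∈ → ∈-⊕⁺ a∈ (∈ₗ⇒∈ b∈))) s₂
      from-B : ∀ {b} → b ∈ B → S ((D ⊕ C) -ₑ b)
      from-B {b} b∈ = P1 _ _ (shift (∈-∪⁺ʳ [ ε ] (∈-∪⁺ˡ (∈-∪⁺ʳ A b∈)))
        (λ {a} a∈ → ∈-resp-≈ (comm a b) (∈-⊕⁺ (∈ₗ⇒∈ a∈) b∈))) s₁
      from-ε : S ((D ⊕ C) -ₑ ε)
      from-ε =
        S⇒S-−ₑε (cut (D ⊕ C) A (P1 _ _ (∪-mono (⊇-⊕[ε] ε∈C) ⊇-refl) s₁) (λ _ → from-A))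
      at : ∀ {c} → c ∈ₗ C → S ((D ⊕ C) -ₑ c)
      at c∈ with ∈ₗ-∪⁻ [ ε ] ((A ∪ B) ∪ D) c∈
      ... | inj₁ (here ≡.refl) = from-ε
      ... | inj₂ c∈R with ∈ₗ-∪⁻ (A ∪ B) D c∈R
      ... | inj₂ d∈ = ∈⇒S-−ₑ (⊇-⊕[ε] ε∈C _ (∈ₗ⇒∈ d∈))
      ... | inj₁ c∈A∪B with ∈ₗ-∪⁻ A B c∈A∪B
      ... | inj₁ a∈ = from-A (∈ₗ⇒∈ a∈)
      ... | inj₂ b∈ = from-B (∈ₗ⇒∈ b∈)

    isRegular : IsRegular G S
    isRegular = record { isEquivariantSystem = sys ; P2 = P2 ; P5 = P5 }

proposition4p1 : {c ℓ₁ ℓ₂ ℓ : Level} (G : PreorderedAbelianGroup c ℓ₁ ℓ₂)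
    (S : FinSub G → Set ℓ) → IsEquivariantSystem G S →
    (Cancellative G S ⇔ IsRegular G S)
proposition4p1 G S E =
  mk⇔ (Cancellative⇒Regular.isRegular G E) (Regular⇒Cancellative.cancellative G)
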